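{- Let $a\in\{1,2\}$ and let $n,t$ be positive integers with $t\le a3^n$. Assume that for all $(m,k)\in T_{a,n}$, $$v_3\big(s(a3^n,a3^m-k)\big)=\frac{a}{2}(3^n-3^m)-(n-m)(a3^m-k)+m-1-v_3\Big(\Big\lfloor\frac{k}{2}\Big\rfloor\Big)+(m+v_3(k))\epsilon_k.$$ Then, if $2\mid (t-a)$, $$v_3\big(s_{3^n}(a3^n,t)\big)=v_3\big(s(a3^n,t)\big)\quad\text{and}\quad v_3\big(s_{3^n}(a3^n,t)-s(a3^n,t)\big)\ge v_3\big(s(a3^n,t)\big)+2;$$ and if $2\nmid (t-a)$, $$v_3\big(s_{3^n}(a3^n,t)\big)\ge v_3\big(s(a3^n,t+1)\big)+n.$$
   Context: $s(N,K)$ denotes the unsigned Stirling number of the first kind (the number of permutations of $N$ elements with exactly $K$ disjoint cycles). For integers $N\ge1$ and $M,K\ge0$, the $M$-th Stirling number of the first kind $s_M(N,K)$ is defined by $(x+M)(x+M+1)\cdots(x+M+N-1)=\sum_{K=0}^N s_M(N,K)x^K$. For an integer $x$, $v_3(x)$ is the exponent of the largest power of $3$ dividing $x$ ($v_3(0)=\infty$). $\epsilon_k=0$ if $k$ is even and $1$ if $k$ is odd. $T_{a,n}=\{(m,k)\in\mathbb{Z}^2: 1\le m\le n,\ 2\le k\le 2a3^{m-1}+1,\ k<a3^m\}$. -}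

module Defs where

open import Data.Nat using (ℕ; zero; suc; _+_; _*_; _∸_; _^_; _≤_; _/_; _%_)
open import Data.List using (List; []; _∷_; [_]; map; zipWith; _++_)
open import Data.Integer as ℤ using (ℤ; +_)

data ℕ∞ : Set where
  fin : ℕ → ℕ∞
  ∞   : ℕ∞

infix 4 _≤∞_
data _≤∞_ : ℕ∞ → ℕ∞ → Set where
  fin≤ : ∀ {m n} → m ≤ n → fin m ≤∞ fin n
  _≤∞∞ : ∀ x → x ≤∞ ∞

infixl 6 _+∞_
_+∞_ : ℕ∞ → ℕ → ℕ∞
fin m +∞ k = fin (m + k)
∞     +∞ k = ∞

-- 3-adic valuation of a positive natural (fuel-based; fuel x suffices
-- since v₃(x) < x for x ≥ 1). Only meaningful for positive arguments.
v3go : ℕ → ℕ → ℕ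
v3go zero    x = 0
v3go (suc f) x with x % 3
... | zero  = suc (v3go f (x / 3))
... | suc _ = 0

v3ℕ : ℕ → ℕ
v3ℕ x = v3go x x

v3 : ℕ → ℕ∞
v3 zero    = ∞
v3 (suc x) = fin (v3ℕ (suc x))

v3ℤ : ℤ → ℕ∞
v3ℤ z = v3 ℤ.∣ z ∣

ε : ℕ → ℕ
ε k = k % 2

-- Polynomials with ℕ coefficients as coefficient lists (constant term first).
-- Multiplication by the linear factor (x + c).
mulLin : ℕ → List ℕ → List ℕ
mulLin c p = zipWith _+_ (map (c *_) p ++ [ 0 ]) (0 ∷ p)

risingPoly : ℕ → ℕ → List ℕ
risingPoly M zero    = [ 1 ]
risingPoly M (suc N) = mulLin (M + N) (risingPoly M N)

coeff : List ℕ → ℕ → ℕ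
coeff []       _       = 0
coeff (x ∷ xs) zero    = x
coeff (x ∷ xs) (suc k) = coeff xs k

stirlingM : ℕ → ℕ → ℕ → ℕ
stirlingM M N K = coeff (risingPoly M N) K

-- Unsigned Stirling number of the first kind s(N,K) = s_0(N,K)
-- (coefficient of x^K in x(x+1)⋯(x+N-1)).
stirling : ℕ → ℕ → ℕ
stirling N K = stirlingM 0 N K

hypRHS : ℕ → ℕ → ℕ → ℕ → ℤ
hypRHS a n m k =
  + ((a * (3 ^ n ∸ 3 ^ m)) / 2)
  ℤ.- (+ (n ∸ m)) ℤ.* (+ (a * 3 ^ m) ℤ.- + k)
  ℤ.+ + m ℤ.- + 1
  ℤ.- + v3ℕ (k / 2)
  ℤ.+ + ((m + v3ℕ k) * ε k)

module Submission where

-- Write N = a·3ⁿ and w(j) = v₃(s(N,j)) + n·j. Expanding (x+3ⁿ)(x+3ⁿ+1)⋯(x+3ⁿ+N−1) in powers of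
-- x + 3ⁿ gives s_{3ⁿ}(N,t) = Σᵢ C(t+i,t)·3ⁿⁱ·s(N,t+i), whose i-th term has valuation at least
-- w(t+i) − n·t. So it suffices that w(t) + 2 ≤ w(j) for t < j ≤ N when t ≡ a (mod 2), and
-- w(t+1) ≤ w(j) for t ≤ j ≤ N otherwise.
-- Every j with 1 ≤ j ≤ N − 2 is a·3^m − k for some (m,k) ∈ T_{a,n}, where k ≡ j + a (mod 2), and
-- there the hypothesis reads w(j) + 1 + v₃(⌊k/2⌋) = A_m + m·j + m + (m + v₃(k))·ε_k with
-- A_m = a(3ⁿ − 3^m)/2 and v₃(⌊k/2⌋) < m. Hence, inside one m-block, w grows by at least 2 past an
-- even k and does not grow past an odd k, while U_m = A_m + m·a·3^m exceeds w by at least 2 where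
-- k is even in block m, is at most w on block m + 1, increases with m, and U_n = n·N ≤ w(j) for
-- j ≥ N − 1.

module Stirling3Adic where

  open import Defs
  open import Data.Nat
  open import Data.Nat.Properties
  open import Data.Nat.Combinatorics using (_C_; k>n⇒nCk≡0; nCn≡1; nCk+nC[k+1]≡[n+1]C[k+1])
  open import Data.Nat.DivMod
  open import Data.Nat.Divisibility
  open import Data.Nat.Solver using (module +-*-Solver)
  import Data.Integer as ℤ
  import Data.Integer.Divisibility as ℤ
  import Data.Integer.Properties as ℤ
  open import Data.List using (List; []; _∷_; [_]; map; zipWith; _++_; length)
  open import Data.Product using (_×_; _,_; ∃-syntax)
  open import Data.Sum using (_⊎_; inj₁; inj₂)
  open import Function using (_∘_)
  open import Function.Bundles using (_⇔_; mk⇔; Equivalence)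
  import Function.Properties.Equivalence as ⇔
  open import Relation.Binary.PropositionalEquality hiding ([_])
  open import Relation.Nullary using (¬_; yes; no; contradiction)

  open +-*-Solver
  open Equivalence using (to; from)

  -- Coefficients of rising factorials

  coeff-zipWith-+ : ∀ (p q : List ℕ) → length p ≡ length q →
                    ∀ k → coeff (zipWith _+_ p q) k ≡ coeff p k + coeff q k
  coeff-zipWith-+ []      []      _  k       = refl
  coeff-zipWith-+ (x ∷ p) (y ∷ q) _  zero    = refl
  coeff-zipWith-+ (x ∷ p) (y ∷ q) eq (suc k) = coeff-zipWith-+ p q (suc-injective eq) k

  length-scale-++-[0] : ∀ c (p : List ℕ) → length (map (c *_) p ++ [ 0 ]) ≡ length (0 ∷ p)
  length-scale-++-[0] c []      = refl
  length-scale-++-[0] c (x ∷ p) = cong suc (length-scale-++-[0] c p)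

  coeff-scale-++-[0] : ∀ c (p : List ℕ) k → coeff (map (c *_) p ++ [ 0 ]) k ≡ c * coeff p k
  coeff-scale-++-[0] c []      zero    = sym (*-zeroʳ c)
  coeff-scale-++-[0] c []      (suc k) = sym (*-zeroʳ c)
  coeff-scale-++-[0] c (x ∷ p) zero    = refl
  coeff-scale-++-[0] c (x ∷ p) (suc k) = coeff-scale-++-[0] c p k

  coeff-mulLin : ∀ c p k → coeff (mulLin c p) k ≡ c * coeff p k + coeff (0 ∷ p) k
  coeff-mulLin c p k = begin
    coeff (mulLin c p) k                                  ≡⟨ coeff-zipWith-+ (map (c *_) p ++ [ 0 ]) (0 ∷ p) (length-scale-++-[0] c p) k ⟩
    coeff (map (c *_) p ++ [ 0 ]) k + coeff (0 ∷ p) k    ≡⟨ cong (_+ coeff (0 ∷ p) k) (coeff-scale-++-[0] c p k) ⟩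
    c * coeff p k + coeff (0 ∷ p) k                       ∎
    where open ≡-Reasoning

  stirlingM-suc-zero : ∀ M N → stirlingM M (suc N) 0 ≡ (M + N) * stirlingM M N 0
  stirlingM-suc-zero M N = trans (coeff-mulLin (M + N) (risingPoly M N) 0) (+-identityʳ _)

  stirlingM-suc-suc : ∀ M N K → stirlingM M (suc N) (suc K) ≡ (M + N) * stirlingM M N (suc K) + stirlingM M N K
  stirlingM-suc-suc M N K = coeff-mulLin (M + N) (risingPoly M N) (suc K)

  stirlingM-vanishes : ∀ M {N K} → N < K → stirlingM M N K ≡ 0
  stirlingM-vanishes M {zero}  {suc K} _ = refl
  stirlingM-vanishes M {suc N} {suc K} (s<s N<K) = begin
    stirlingM M (suc N) (suc K)                            ≡⟨ stirlingM-suc-suc M N K ⟩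
    (M + N) * stirlingM M N (suc K) + stirlingM M N K      ≡⟨ cong₂ (λ x y → (M + N) * x + y)
                                                               (stirlingM-vanishes M (m<n⇒m<1+n N<K)) (stirlingM-vanishes M N<K) ⟩
    (M + N) * 0 + 0                                        ≡⟨ cong (_+ 0) (*-zeroʳ (M + N)) ⟩
    0                                                      ∎
    where open ≡-Reasoning

  stirlingM-diag : ∀ M N → stirlingM M N N ≡ 1
  stirlingM-diag M zero    = refl
  stirlingM-diag M (suc N) = begin
    stirlingM M (suc N) (suc N)                        ≡⟨ stirlingM-suc-suc M N N ⟩
    (M + N) * stirlingM M N (suc N) + stirlingM M N N  ≡⟨ cong₂ (λ x y → (M + N) * x + y)
                                                           (stirlingM-vanishes M (n<1+n N)) (stirlingM-diag M N) ⟩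
    (M + N) * 0 + 1                                    ≡⟨ cong (_+ 1) (*-zeroʳ (M + N)) ⟩
    1                                                  ∎
    where open ≡-Reasoning

  stirling-pos : ∀ {N K} → 1 ≤ K → K ≤ N → 0 < stirling N K
  stirling-pos {suc zero}    {suc zero}    _ _         = s≤s z≤n
  stirling-pos {suc (suc N)} {suc zero}    _ _         =
    subst (0 <_) (sym (stirlingM-suc-suc 0 (suc N) 0))
      (m≤n⇒m≤n+o (stirling (suc N) 0) (<-≤-trans (stirling-pos {suc N} (s≤s z≤n) (s≤s z≤n)) (m≤n*m (stirling (suc N) 1) (suc N))))
  stirling-pos {suc N}       {suc (suc K)} _ (s≤s K<N) =
    subst (0 <_) (sym (stirlingM-suc-suc 0 N (suc K))) (m≤n⇒m≤o+n (N * _) (stirling-pos (s≤s z≤n) K<N))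

  stirling-subdiagonal : ∀ K → stirling (suc K) K * 2 ≡ suc K * K
  stirling-subdiagonal zero    = refl
  stirling-subdiagonal (suc K) = begin
    stirling (2 + K) (suc K) * 2                              ≡⟨ cong (_* 2) (stirlingM-suc-suc 0 (suc K) K) ⟩
    (suc K * stirling (suc K) (suc K) + stirling (suc K) K) * 2 ≡⟨ cong (λ x → (suc K * x + stirling (suc K) K) * 2) (stirlingM-diag 0 (suc K)) ⟩
    (suc K * 1 + stirling (suc K) K) * 2                      ≡⟨ solve 2 (λ k x → (k :* con 1 :+ x) :* con 2 := k :* con 2 :+ x :* con 2)
                                                                   refl (suc K) _ ⟩
    suc K * 2 + stirling (suc K) K * 2                        ≡⟨ cong (suc K * 2 +_) (stirling-subdiagonal K) ⟩
    suc K * 2 + suc K * K                                     ≡⟨ *-distribˡ-+ (suc K) 2 K ⟨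
    suc K * (2 + K)                                           ≡⟨ *-comm (suc K) (2 + K) ⟩
    (2 + K) * suc K                                           ∎
    where open ≡-Reasoning

  -- Expansion of s_M(N,t) in the s(N,K)

  ∑< : ℕ → (ℕ → ℕ) → ℕ
  ∑< zero    f = 0
  ∑< (suc B) f = f 0 + ∑< B (f ∘ suc)

  syntax ∑< B (λ i → e) = ∑[ i < B ] e

  ∑-cong : ∀ B {f g : ℕ → ℕ} → (∀ i → f i ≡ g i) → ∑< B f ≡ ∑< B g
  ∑-cong zero    f≗g = refl
  ∑-cong (suc B) f≗g = cong₂ _+_ (f≗g 0) (∑-cong B (f≗g ∘ suc))

  ∑-distrib-+ : ∀ B (f g : ℕ → ℕ) → ∑[ i < B ] (f i + g i) ≡ ∑< B f + ∑< B g
  ∑-distrib-+ zero    f g = refl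
  ∑-distrib-+ (suc B) f g = begin
    f 0 + g 0 + ∑[ i < B ] (f (suc i) + g (suc i))  ≡⟨ cong ((f 0 + g 0) +_) (∑-distrib-+ B (f ∘ suc) (g ∘ suc)) ⟩
    f 0 + g 0 + (∑< B (f ∘ suc) + ∑< B (g ∘ suc))  ≡⟨ solve 4 (λ a b x y → a :+ b :+ (x :+ y) := a :+ x :+ (b :+ y)) refl (f 0) (g 0) _ _ ⟩
    f 0 + ∑< B (f ∘ suc) + (g 0 + ∑< B (g ∘ suc))  ∎
    where open ≡-Reasoning

  ∑-distribˡ-* : ∀ B c (f : ℕ → ℕ) → ∑[ i < B ] (c * f i) ≡ c * ∑< B f
  ∑-distribˡ-* zero    c f = sym (*-zeroʳ c)
  ∑-distribˡ-* (suc B) c f = trans (cong (c * f 0 +_) (∑-distribˡ-* B c (f ∘ suc))) (sym (*-distribˡ-+ c (f 0) _))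

  ∑-zero : ∀ B {f : ℕ → ℕ} → (∀ i → f i ≡ 0) → ∑< B f ≡ 0
  ∑-zero zero    _   = refl
  ∑-zero (suc B) f≗0 = cong₂ _+_ (f≗0 0) (∑-zero B (f≗0 ∘ suc))

  ∑-divisible : ∀ B {d} {f : ℕ → ℕ} → (∀ i → d ∣ f i) → d ∣ ∑< B f
  ∑-divisible zero    {d} _   = d ∣0
  ∑-divisible (suc B)     d∣f = ∣m∣n⇒∣m+n (d∣f 0) (∑-divisible B (d∣f ∘ suc))

  module Shift (M : ℕ) where

    shiftTerm : ℕ → ℕ → ℕ → ℕ
    shiftTerm N t i = ((t + i) C t) * (M ^ i * stirling N (t + i))

    shiftTerm-vanishes : ∀ {N t i} → N < t + i → shiftTerm N t i ≡ 0
    shiftTerm-vanishes {N} {t} {i} N<t+i = begin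
      ((t + i) C t) * (M ^ i * stirling N (t + i))  ≡⟨ cong (λ x → ((t + i) C t) * (M ^ i * x)) (stirlingM-vanishes 0 N<t+i) ⟩
      ((t + i) C t) * (M ^ i * 0)                   ≡⟨ cong (((t + i) C t) *_) (*-zeroʳ (M ^ i)) ⟩
      ((t + i) C t) * 0                             ≡⟨ *-zeroʳ ((t + i) C t) ⟩
      0                                             ∎
      where open ≡-Reasoning

    shiftTerm-head : ∀ N t → shiftTerm N t 0 ≡ stirling N t
    shiftTerm-head N t = begin
      ((t + 0) C t) * (1 * stirling N (t + 0))  ≡⟨ cong (λ u → (u C t) * (1 * stirling N u)) (+-identityʳ t) ⟩
      (t C t) * (1 * stirling N t)              ≡⟨ cong (_* (1 * stirling N t)) (nCn≡1 t) ⟩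
      1 * (1 * stirling N t)                    ≡⟨ solve 1 (λ x → con 1 :* (con 1 :* x) := x) refl (stirling N t) ⟩
      stirling N t                              ∎
      where open ≡-Reasoning

    shiftTerm-suc-zero-zero : ∀ N → shiftTerm (suc N) 0 0 ≡ N * shiftTerm N 0 0
    shiftTerm-suc-zero-zero N rewrite stirlingM-suc-zero 0 N =
      solve 2 (λ n x → con 1 :* (con 1 :* (n :* x)) := n :* (con 1 :* (con 1 :* x))) refl N (stirling N 0)

    shiftTerm-suc-zero-suc : ∀ N i → shiftTerm (suc N) 0 (suc i) ≡ N * shiftTerm N 0 (suc i) + M * shiftTerm N 0 i
    shiftTerm-suc-zero-suc N i rewrite stirlingM-suc-suc 0 N i =
      solve 5 (λ n m mⁱ x y → con 1 :* ((m :* mⁱ) :* (n :* x :+ y))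
                            := n :* (con 1 :* ((m :* mⁱ) :* x)) :+ m :* (con 1 :* (mⁱ :* y)))
        refl N M (M ^ i) (stirling N (suc i)) (stirling N i)

    carry : ℕ → ℕ → ℕ → ℕ
    carry N t i = ((t + i) C suc t) * (M ^ i * stirling N (t + i))

    shiftTerm-suc-suc : ∀ N t i → shiftTerm (suc N) (suc t) i ≡ N * shiftTerm N (suc t) i + shiftTerm N t i + carry N t i
    shiftTerm-suc-suc N t i rewrite stirlingM-suc-suc 0 N (t + i) | sym (nCk+nC[k+1]≡[n+1]C[k+1] (t + i) t) =
      solve 6 (λ n c c′ mⁱ x y → (c :+ c′) :* (mⁱ :* (n :* x :+ y))
                               := n :* ((c :+ c′) :* (mⁱ :* x)) :+ c :* (mⁱ :* y) :+ c′ :* (mⁱ :* y))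
        refl N ((t + i) C t) ((t + i) C suc t) (M ^ i) (stirling N (suc (t + i))) (stirling N (t + i))

    ∑-carry : ∀ N t B → ∑< (suc B) (carry N t) ≡ M * ∑< B (shiftTerm N (suc t))
    ∑-carry N t B = begin
      carry N t 0 + ∑< B (carry N t ∘ suc)           ≡⟨ cong₂ _+_ carry-head (∑-cong B carry-suc) ⟩
      0 + ∑[ i < B ] (M * shiftTerm N (suc t) i)     ≡⟨ ∑-distribˡ-* B M (shiftTerm N (suc t)) ⟩
      M * ∑< B (shiftTerm N (suc t))                 ∎
      where
      open ≡-Reasoning
      carry-head : carry N t 0 ≡ 0
      carry-head rewrite +-identityʳ t | k>n⇒nCk≡0 (n<1+n t) = refl
      carry-suc : ∀ i → carry N t (suc i) ≡ M * shiftTerm N (suc t) i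
      carry-suc i rewrite +-suc t i =
        solve 4 (λ c m mⁱ x → c :* ((m :* mⁱ) :* x) := m :* (c :* (mⁱ :* x))) refl
          (suc (t + i) C suc t) M (M ^ i) (stirling N (suc (t + i)))

    ∑-shiftTerm-suc-zero : ∀ N B → ∑< (suc B) (shiftTerm (suc N) 0)
                                  ≡ N * ∑< (suc B) (shiftTerm N 0) + M * ∑< B (shiftTerm N 0)
    ∑-shiftTerm-suc-zero N B = begin
      T′ 0 + ∑< B (T′ ∘ suc)
        ≡⟨ cong₂ _+_ (shiftTerm-suc-zero-zero N) (∑-cong B (shiftTerm-suc-zero-suc N)) ⟩
      N * T 0 + ∑[ i < B ] (N * T (suc i) + M * T i)
        ≡⟨ cong (N * T 0 +_) (∑-distrib-+ B (λ i → N * T (suc i)) (λ i → M * T i)) ⟩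
      N * T 0 + (∑[ i < B ] (N * T (suc i)) + ∑[ i < B ] (M * T i))
        ≡⟨ cong₂ (λ x y → N * T 0 + (x + y)) (∑-distribˡ-* B N (T ∘ suc)) (∑-distribˡ-* B M T) ⟩
      N * T 0 + (N * ∑< B (T ∘ suc) + M * ∑< B T)
        ≡⟨ solve 5 (λ n m x y z → n :* x :+ (n :* y :+ m :* z) := n :* (x :+ y) :+ m :* z) refl N M (T 0) _ _ ⟩
      N * (T 0 + ∑< B (T ∘ suc)) + M * ∑< B T
        ∎
      where
      open ≡-Reasoning
      T T′ : ℕ → ℕ
      T  = shiftTerm N 0
      T′ = shiftTerm (suc N) 0

    ∑-shiftTerm-suc-suc : ∀ N t B → ∑< (suc B) (shiftTerm (suc N) (suc t))
                                    ≡ N * ∑< (suc B) (shiftTerm N (suc t)) + ∑< (suc B) (shiftTerm N t)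
                                      + M * ∑< B (shiftTerm N (suc t))
    ∑-shiftTerm-suc-suc N t B = begin
      ∑< (suc B) (shiftTerm (suc N) (suc t))
        ≡⟨ ∑-cong (suc B) (shiftTerm-suc-suc N t) ⟩
      ∑[ i < suc B ] (N * T₁ i + T₀ i + carry N t i)
        ≡⟨ ∑-distrib-+ (suc B) (λ i → N * T₁ i + T₀ i) (carry N t) ⟩
      ∑[ i < suc B ] (N * T₁ i + T₀ i) + ∑< (suc B) (carry N t)
        ≡⟨ cong₂ _+_ (∑-distrib-+ (suc B) (λ i → N * T₁ i) T₀) (∑-carry N t B) ⟩
      ∑[ i < suc B ] (N * T₁ i) + ∑< (suc B) T₀ + M * ∑< B T₁
        ≡⟨ cong (λ x → x + ∑< (suc B) T₀ + M * ∑< B T₁) (∑-distribˡ-* (suc B) N T₁) ⟩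
      N * ∑< (suc B) T₁ + ∑< (suc B) T₀ + M * ∑< B T₁
        ∎
      where
      open ≡-Reasoning
      T₀ T₁ : ℕ → ℕ
      T₀ = shiftTerm N t
      T₁ = shiftTerm N (suc t)

    stirlingM-shift : ∀ N t B → N < t + B → stirlingM M N t ≡ ∑< B (shiftTerm N t)
    stirlingM-shift N t zero N<t+0 = stirlingM-vanishes M (subst (N <_) (+-identityʳ t) N<t+0)
    stirlingM-shift zero zero (suc B) _ =
      sym (cong suc (∑-zero B (λ i → shiftTerm-vanishes {0} {0} {suc i} (s≤s z≤n))))
    stirlingM-shift zero (suc t) (suc B) _ =
      sym (∑-zero (suc B) (λ i → shiftTerm-vanishes {0} {suc t} {i} (s≤s z≤n)))
    stirlingM-shift (suc N) zero (suc B) (s<s N<B) = begin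
      stirlingM M (suc N) 0
        ≡⟨ stirlingM-suc-zero M N ⟩
      (M + N) * stirlingM M N 0
        ≡⟨ *-distribʳ-+ (stirlingM M N 0) M N ⟩
      M * stirlingM M N 0 + N * stirlingM M N 0
        ≡⟨ cong₂ (λ x y → M * x + N * y) (stirlingM-shift N 0 B N<B) (stirlingM-shift N 0 (suc B) (m<n⇒m<1+n N<B)) ⟩
      M * ∑< B (shiftTerm N 0) + N * ∑< (suc B) (shiftTerm N 0)
        ≡⟨ +-comm (M * ∑< B (shiftTerm N 0)) _ ⟩
      N * ∑< (suc B) (shiftTerm N 0) + M * ∑< B (shiftTerm N 0)
        ≡⟨ ∑-shiftTerm-suc-zero N B ⟨
      ∑< (suc B) (shiftTerm (suc N) 0)
        ∎
      where open ≡-Reasoning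
    stirlingM-shift (suc N) (suc t) (suc B) (s<s N<t+1+B) = begin
      stirlingM M (suc N) (suc t)
        ≡⟨ stirlingM-suc-suc M N t ⟩
      (M + N) * stirlingM M N (suc t) + stirlingM M N t
        ≡⟨ cong (_+ stirlingM M N t) (*-distribʳ-+ (stirlingM M N (suc t)) M N) ⟩
      M * stirlingM M N (suc t) + N * stirlingM M N (suc t) + stirlingM M N t
        ≡⟨ cong₂ (λ x y → M * x + N * y + stirlingM M N t)
             (stirlingM-shift N (suc t) B (subst (N <_) (+-suc t B) N<t+1+B))
             (stirlingM-shift N (suc t) (suc B) (m<n⇒m<1+n N<t+1+B)) ⟩
      M * ∑< B T₁ + N * ∑< (suc B) T₁ + stirlingM M N t
        ≡⟨ cong (M * ∑< B T₁ + N * ∑< (suc B) T₁ +_) (stirlingM-shift N t (suc B) N<t+1+B) ⟩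
      M * ∑< B T₁ + N * ∑< (suc B) T₁ + ∑< (suc B) (shiftTerm N t)
        ≡⟨ solve 3 (λ x y z → x :+ y :+ z := y :+ z :+ x) refl (M * ∑< B T₁) _ _ ⟩
      N * ∑< (suc B) T₁ + ∑< (suc B) (shiftTerm N t) + M * ∑< B T₁
        ≡⟨ ∑-shiftTerm-suc-suc N t B ⟨
      ∑< (suc B) (shiftTerm (suc N) (suc t))
        ∎
      where
      open ≡-Reasoning
      T₁ : ℕ → ℕ
      T₁ = shiftTerm N (suc t)

  -- 3-adic valuation

  ^-monoʳ-∣ : ∀ b {m n} → m ≤ n → b ^ m ∣ b ^ n
  ^-monoʳ-∣ b {m} {n} m≤n = divides (b ^ (n ∸ m)) (begin
    b ^ n                ≡⟨ cong (b ^_) (m∸n+n≡m m≤n) ⟨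
    b ^ (n ∸ m + m)      ≡⟨ ^-distribˡ-+-* b (n ∸ m) m ⟩
    b ^ (n ∸ m) * b ^ m  ∎)
    where open ≡-Reasoning

  m%3≡0⇒m≡3*[m/3] : ∀ {x} → x % 3 ≡ 0 → x ≡ 3 * (x / 3)
  m%3≡0⇒m≡3*[m/3] {x} x%3≡0 = sym (m*[n/m]≡n (m%n≡0⇒n∣m x 3 x%3≡0))

  3^v3go∣ : ∀ f x → 3 ^ v3go f x ∣ x
  3^v3go∣ zero    x = 1∣ x
  3^v3go∣ (suc f) x with x % 3 in x%3
  ... | zero  = subst (3 * 3 ^ v3go f (x / 3) ∣_) (sym (m%3≡0⇒m≡3*[m/3] x%3)) (*-monoʳ-∣ 3 (3^v3go∣ f (x / 3)))
  ... | suc _ = 1∣ x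

  v3go-maximal : ∀ f x k → 0 < x → x ≤ f → 3 ^ k ∣ x → k ≤ v3go f x
  v3go-maximal f       x zero    _   _   _     = z≤n
  v3go-maximal zero    x (suc k) 0<x x≤0 _     = contradiction x≤0 (<⇒≱ 0<x)
  v3go-maximal (suc f) x (suc k) 0<x x≤f 3ᵏ⁺¹∣x with x % 3 in x%3
  ... | zero  = s≤s (v3go-maximal f (x / 3) k (m≥n⇒m/n>0 3≤x) x/3≤f
                      (*-cancelˡ-∣ 3 (subst (3 * 3 ^ k ∣_) (m%3≡0⇒m≡3*[m/3] x%3) 3ᵏ⁺¹∣x)))
    where
    3≤x : 3 ≤ x
    3≤x = ∣⇒≤ {{>-nonZero 0<x}} (∣-trans (m∣m*n (3 ^ k)) 3ᵏ⁺¹∣x)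
    x/3≤f : x / 3 ≤ f
    x/3≤f = ≤-pred (≤-trans (m/n<m x 3 {{>-nonZero 0<x}} (s≤s (s≤s z≤n))) x≤f)
  ... | suc _ = contradiction (trans (sym (n∣m⇒m%n≡0 x 3 (∣-trans (m∣m*n (3 ^ k)) 3ᵏ⁺¹∣x))) x%3) 0≢1+n

  3^v3ℕ∣ : ∀ x → 3 ^ v3ℕ x ∣ x
  3^v3ℕ∣ x = 3^v3go∣ x x

  v3ℕ-maximal : ∀ {x k} → 0 < x → 3 ^ k ∣ x → k ≤ v3ℕ x
  v3ℕ-maximal {x} {k} 0<x = v3go-maximal x x k 0<x ≤-refl

  v3ℕ-unique : ∀ {x e} → 0 < x → 3 ^ e ∣ x → ¬ (3 ^ suc e ∣ x) → v3ℕ x ≡ e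
  v3ℕ-unique {x} {e} 0<x 3ᵉ∣x 3ᵉ⁺¹∤x with v3ℕ x ≤? e
  ... | yes v≤e = ≤-antisym v≤e (v3ℕ-maximal 0<x 3ᵉ∣x)
  ... | no  v≰e = contradiction (∣-trans (^-monoʳ-∣ 3 (≰⇒> v≰e)) (3^v3ℕ∣ x)) 3ᵉ⁺¹∤x

  v3-positive : ∀ {x} → 0 < x → v3 x ≡ fin (v3ℕ x)
  v3-positive {suc x} _ = refl

  v3≡fin⇒v3ℕ≡ : ∀ {x e} → v3 x ≡ fin e → v3ℕ x ≡ e
  v3≡fin⇒v3ℕ≡ {suc x} refl = refl

  3^k∣⇒k≤v3 : ∀ {x k} → 3 ^ k ∣ x → fin k ≤∞ v3 x
  3^k∣⇒k≤v3 {zero}  {k} _    = fin k ≤∞∞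
  3^k∣⇒k≤v3 {suc x}     3ᵏ∣x = fin≤ (v3ℕ-maximal (s≤s z≤n) 3ᵏ∣x)

  3^e∣x*2⇒3^e∣x : ∀ e x → 3 ^ e ∣ x * 2 → 3 ^ e ∣ x
  3^e∣x*2⇒3^e∣x zero    x _        = 1∣ x
  3^e∣x*2⇒3^e∣x (suc e) x 3ᵉ⁺¹∣x*2 = subst (3 ^ suc e ∣_) (sym x≡3*[x/3]) (*-monoʳ-∣ 3 (3^e∣x*2⇒3^e∣x e (x / 3) 3ᵉ∣[x/3]*2))
    where
    3∣x : 3 ∣ x
    3∣x = ∣m+n∣m⇒∣n (subst (3 ∣_) (solve 1 (λ x → x :* con 3 := x :* con 2 :+ x) refl x) (n∣m*n x))
                    (∣-trans (m∣m*n (3 ^ e)) 3ᵉ⁺¹∣x*2)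
    x≡3*[x/3] : x ≡ 3 * (x / 3)
    x≡3*[x/3] = sym (m*[n/m]≡n 3∣x)
    3ᵉ∣[x/3]*2 : 3 ^ e ∣ x / 3 * 2
    3ᵉ∣[x/3]*2 = *-cancelˡ-∣ 3 (subst (3 * 3 ^ e ∣_) (trans (cong (_* 2) x≡3*[x/3]) (*-assoc 3 (x / 3) 2)) 3ᵉ⁺¹∣x*2)

  v3ℕ-+-dominated : ∀ {x y} → 0 < x → 3 ^ suc (v3ℕ x) ∣ y → v3ℕ (x + y) ≡ v3ℕ x
  v3ℕ-+-dominated {x} {y} 0<x 3ᵛ⁺¹∣y = v3ℕ-unique (<-≤-trans 0<x (m≤m+n x y))
    (∣m∣n⇒∣m+n (3^v3ℕ∣ x) (∣-trans (^-monoʳ-∣ 3 (n≤1+n (v3ℕ x))) 3ᵛ⁺¹∣y))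
    (λ 3ᵛ⁺¹∣x+y → <-irrefl refl (v3ℕ-maximal 0<x (∣m+n∣m⇒∣n (subst (3 ^ suc (v3ℕ x) ∣_) (+-comm x y) 3ᵛ⁺¹∣x+y) 3ᵛ⁺¹∣y)))

  3^e∣1+K⇒e≤v3[s[1+K,K]] : ∀ e K → 1 ≤ K → 3 ^ e ∣ suc K → e ≤ v3ℕ (stirling (suc K) K)
  3^e∣1+K⇒e≤v3[s[1+K,K]] e K 1≤K 3ᵉ∣1+K = v3ℕ-maximal (stirling-pos 1≤K (n≤1+n K))
    (3^e∣x*2⇒3^e∣x e _ (subst (3 ^ e ∣_) (sym (stirling-subdiagonal K)) (∣-trans 3ᵉ∣1+K (m∣m*n K))))

  [+m+n]-[+m]≡+n : ∀ m n → ℤ.+ (m + n) ℤ.- ℤ.+ m ≡ ℤ.+ n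
  [+m+n]-[+m]≡+n m n = trans (ℤ.[+m]-[+n]≡m⊖n (m + n) m) (trans (ℤ.⊖-≥ (m≤m+n m n)) (cong ℤ.+_ (m+n∸m≡n m n)))

  module ShiftValuation (n N : ℕ) where

    open Shift (3 ^ n)

    weight : ℕ → ℕ
    weight j = v3ℕ (stirling N j) + n * j

    3^[ni+v3]∣[3^n]^i* : ∀ {i} x → 3 ^ (n * i + v3ℕ x) ∣ (3 ^ n) ^ i * x
    3^[ni+v3]∣[3^n]^i* {i} x = subst (_∣ (3 ^ n) ^ i * x) (sym 3^[ni+v]≡[3^n]^i*3^v) (*-monoʳ-∣ ((3 ^ n) ^ i) (3^v3ℕ∣ x))
      where
      3^[ni+v]≡[3^n]^i*3^v : 3 ^ (n * i + v3ℕ x) ≡ (3 ^ n) ^ i * 3 ^ v3ℕ x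
      3^[ni+v]≡[3^n]^i*3^v = trans (^-distribˡ-+-* 3 (n * i) (v3ℕ x)) (cong (_* 3 ^ v3ℕ x) (sym (^-*-assoc 3 n i)))

    3^e∣shiftTerm : ∀ {e t i} → (t + i ≤ N → e + n * t ≤ weight (t + i)) → 3 ^ e ∣ shiftTerm N t i
    3^e∣shiftTerm {e} {t} {i} bound with t + i ≤? N
    ... | no  t+i≰N = subst (3 ^ e ∣_) (sym (shiftTerm-vanishes {N} {t} {i} (≰⇒> t+i≰N))) ((3 ^ e) ∣0)
    ... | yes t+i≤N = ∣-trans (^-monoʳ-∣ 3 e≤ni+v) (∣-trans (3^[ni+v3]∣[3^n]^i* (stirling N (t + i))) (n∣m*n ((t + i) C t)))
      where
      e≤ni+v : e ≤ n * i + v3ℕ (stirling N (t + i))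
      e≤ni+v = +-cancelʳ-≤ (n * t) e _ (begin
        e + n * t                                   ≤⟨ bound t+i≤N ⟩
        v3ℕ (stirling N (t + i)) + n * (t + i)      ≡⟨ solve 4 (λ v n t i → v :+ n :* (t :+ i) := n :* i :+ v :+ n :* t) refl
                                                         (v3ℕ (stirling N (t + i))) n t i ⟩
        n * i + v3ℕ (stirling N (t + i)) + n * t    ∎)
        where open ≤-Reasoning

    stirlingM-split : ∀ t → stirlingM (3 ^ n) N t ≡ stirling N t + ∑[ i < N ] shiftTerm N t (suc i)
    stirlingM-split t = trans (stirlingM-shift N t (suc N) (m≤n+m (suc N) t))
                              (cong (_+ ∑[ i < N ] shiftTerm N t (suc i)) (shiftTerm-head N t))

    v3-stirlingM-gap : ∀ {t} → 0 < stirling N t → (∀ j → t < j → j ≤ N → weight t + 2 ≤ weight j) →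
      (v3 (stirlingM (3 ^ n) N t) ≡ v3 (stirling N t))
      × (v3 (stirling N t) +∞ 2 ≤∞ v3ℤ (ℤ.+ stirlingM (3 ^ n) N t ℤ.- ℤ.+ stirling N t))
    v3-stirlingM-gap {t} 0<s gap = v3-equal , v3-difference
      where
      s = stirling N t
      v = v3ℕ s
      tail = ∑[ i < N ] shiftTerm N t (suc i)
      3ᵛ⁺²∣tail : 3 ^ (v + 2) ∣ tail
      3ᵛ⁺²∣tail = ∑-divisible N (λ i → 3^e∣shiftTerm (λ t+1+i≤N → begin
        v + 2 + n * t           ≡⟨ solve 3 (λ v n t → v :+ con 2 :+ n :* t := v :+ n :* t :+ con 2) refl v n t ⟩
        weight t + 2            ≤⟨ gap (t + suc i) (m<m+n t (s≤s z≤n)) t+1+i≤N ⟩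
        weight (t + suc i)      ∎))
        where open ≤-Reasoning
      0<s+tail : 0 < s + tail
      0<s+tail = <-≤-trans 0<s (m≤m+n s tail)
      v3-equal : v3 (stirlingM (3 ^ n) N t) ≡ v3 s
      v3-equal = begin
        v3 (stirlingM (3 ^ n) N t)  ≡⟨ cong v3 (stirlingM-split t) ⟩
        v3 (s + tail)               ≡⟨ v3-positive 0<s+tail ⟩
        fin (v3ℕ (s + tail))        ≡⟨ cong fin (v3ℕ-+-dominated 0<s (∣-trans (^-monoʳ-∣ 3 (m<m+n v (s≤s z≤n))) 3ᵛ⁺²∣tail)) ⟩
        fin v                       ≡⟨ v3-positive 0<s ⟨
        v3 s                        ∎
        where open ≡-Reasoning
      v3-difference : v3 s +∞ 2 ≤∞ v3ℤ (ℤ.+ stirlingM (3 ^ n) N t ℤ.- ℤ.+ s)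
      v3-difference rewrite v3-positive 0<s | stirlingM-split t | [+m+n]-[+m]≡+n s tail = 3^k∣⇒k≤v3 3ᵛ⁺²∣tail

    v3-stirlingM-lower : ∀ {t} → 0 < stirling N (suc t) → (∀ j → t ≤ j → j ≤ N → weight (suc t) ≤ weight j) →
      v3 (stirling N (suc t)) +∞ n ≤∞ v3 (stirlingM (3 ^ n) N t)
    v3-stirlingM-lower {t} 0<s minimal rewrite v3-positive 0<s | stirlingM-shift N t (suc N) (m≤n+m (suc N) t) =
      3^k∣⇒k≤v3 (∑-divisible (suc N) (λ i → 3^e∣shiftTerm (λ t+i≤N → begin
        v + n + n * t       ≡⟨ solve 3 (λ v n t → v :+ n :+ n :* t := v :+ n :* (con 1 :+ t)) refl v n t ⟩
        weight (suc t)      ≤⟨ minimal (t + i) (m≤m+n t i) t+i≤N ⟩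
        weight (t + i)      ∎)))
      where
      open ≤-Reasoning
      v = v3ℕ (stirling N (suc t))

  -- Parity

  k%2≡0⊎k%2≡1 : ∀ k → k % 2 ≡ 0 ⊎ k % 2 ≡ 1
  k%2≡0⊎k%2≡1 zero          = inj₁ refl
  k%2≡0⊎k%2≡1 (suc zero)    = inj₂ refl
  k%2≡0⊎k%2≡1 (suc (suc k)) = k%2≡0⊎k%2≡1 k

  odd⇒pred-even : ∀ k → suc k % 2 ≡ 1 → k % 2 ≡ 0
  odd⇒pred-even zero          _  = refl
  odd⇒pred-even (suc (suc k)) eq = odd⇒pred-even k eq

  even⇒pred-odd : ∀ k → suc k % 2 ≡ 0 → k % 2 ≡ 1
  even⇒pred-odd (suc zero)    _  = refl
  even⇒pred-odd (suc (suc k)) eq = even⇒pred-odd k eq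

  odd⇒pred≥2 : ∀ {k} → 2 ≤ suc k → suc k % 2 ≡ 1 → 2 ≤ k
  odd⇒pred≥2 {zero}          (s≤s ()) _
  odd⇒pred≥2 {suc (suc k)} _        _ = s≤s (s≤s z≤n)

  [2x+1]%2≡1 : ∀ x → (2 * x + 1) % 2 ≡ 1
  [2x+1]%2≡1 x = trans (cong (_% 2) (solve 1 (λ x → con 2 :* x :+ con 1 := con 1 :+ x :* con 2) refl x)) ([m+kn]%n≡m%n 1 x 2)

  even⇒[1+k]/2≡k/2 : ∀ k → k % 2 ≡ 0 → suc k / 2 ≡ k / 2
  even⇒[1+k]/2≡k/2 zero          _  = refl
  even⇒[1+k]/2≡k/2 (suc (suc k)) eq = begin
    suc (suc (suc k)) / 2  ≡⟨ m/n≡1+[m∸n]/n {suc (suc (suc k))} {2} (s≤s (s≤s z≤n)) ⟩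
    suc (suc k / 2)        ≡⟨ cong suc (even⇒[1+k]/2≡k/2 k eq) ⟩
    suc (k / 2)            ≡⟨ m/n≡1+[m∸n]/n {suc (suc k)} {2} (s≤s (s≤s z≤n)) ⟨
    suc (suc k) / 2        ∎
    where open ≡-Reasoning

  k≤2x+1⇒k/2≤x : ∀ {k} x → k ≤ 2 * x + 1 → k / 2 ≤ x
  k≤2x+1⇒k/2≤x {k} x k≤2x+1 = ≤-pred (m<n*o⇒m/o<n (subst (k <_) 2x+2≡[1+x]*2 (s≤s k≤2x+1)))
    where
    2x+2≡[1+x]*2 : suc (2 * x + 1) ≡ suc x * 2
    2x+2≡[1+x]*2 = solve 1 (λ x → con 1 :+ (con 2 :* x :+ con 1) := (con 1 :+ x) :* con 2) refl x

  2∣y*2+x⇔2∣x : ∀ x y → 2 ∣ y * 2 + x ⇔ 2 ∣ x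
  2∣y*2+x⇔2∣x x y = mk⇔ (λ 2∣y*2+x → ∣m+n∣m⇒∣n 2∣y*2+x (n∣m*n y)) (∣m∣n⇒∣m+n (n∣m*n y))

  2∣m+n⇔2∣∣m⊖n∣ : ∀ m n → 2 ∣ m + n ⇔ 2 ∣ ℤ.∣ m ℤ.⊖ n ∣
  2∣m+n⇔2∣∣m⊖n∣ m n with ≤-total m n
  ... | inj₁ m≤n = subst₂ (λ x y → 2 ∣ x ⇔ 2 ∣ y) m*2+[n∸m]≡m+n (sym (ℤ.∣⊖∣-≤ m≤n)) (2∣y*2+x⇔2∣x (n ∸ m) m)
    where
    m*2+[n∸m]≡m+n : m * 2 + (n ∸ m) ≡ m + n
    m*2+[n∸m]≡m+n = trans (solve 2 (λ m d → m :* con 2 :+ d := m :+ (d :+ m)) refl m (n ∸ m)) (cong (m +_) (m∸n+n≡m m≤n))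
  ... | inj₂ n≤m = subst₂ (λ x y → 2 ∣ x ⇔ 2 ∣ y) n*2+[m∸n]≡m+n (sym (cong ℤ.∣_∣ (ℤ.⊖-≥ n≤m))) (2∣y*2+x⇔2∣x (m ∸ n) n)
    where
    n*2+[m∸n]≡m+n : n * 2 + (m ∸ n) ≡ m + n
    n*2+[m∸n]≡m+n = trans (solve 2 (λ n d → n :* con 2 :+ d := d :+ n :+ n) refl n (m ∸ n)) (cong (_+ n) (m∸n+n≡m n≤m))

  2∣a*3^m+a : ∀ a m → 2 ∣ a * 3 ^ m + a
  2∣a*3^m+a a m = subst (2 ∣_) (solve 2 (λ a x → a :* (x :+ con 1) := a :* x :+ a) refl a (3 ^ m))
                        (∣-trans (2∣3^m+1 m) (n∣m*n a))
    where
    2∣3^m+1 : ∀ m → 2 ∣ 3 ^ m + 1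
    2∣3^m+1 zero    = ∣-refl
    2∣3^m+1 (suc m) = subst (2 ∣_) (solve 1 (λ x → x :* con 2 :+ (x :+ con 1) := con 3 :* x :+ con 1) refl (3 ^ m))
                        (∣m∣n⇒∣m+n (n∣m*n (3 ^ m)) (2∣3^m+1 m))

  2∣[t-a]⇔k%2≡0 : ∀ a m {t k} → t + k ≡ a * 3 ^ m → ℤ.+ 2 ℤ.∣ (ℤ.+ t ℤ.- ℤ.+ a) ⇔ k % 2 ≡ 0
  2∣[t-a]⇔k%2≡0 a m {t} {k} t+k≡a3ᵐ =
    subst (λ z → 2 ∣ ℤ.∣ z ∣ ⇔ k % 2 ≡ 0) (sym (ℤ.[+m]-[+n]≡m⊖n t a))
      (⇔.trans (⇔.sym (2∣m+n⇔2∣∣m⊖n∣ t a)) (⇔.trans 2∣t+a⇔2∣k (⇔.sym (m%n≡0⇔n∣m k 2))))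
    where
    2∣t+a+k : 2 ∣ t + a + k
    2∣t+a+k = subst (2 ∣_) (trans (cong (_+ a) (sym t+k≡a3ᵐ)) (solve 3 (λ t k a → t :+ k :+ a := t :+ a :+ k) refl t k a))
                    (2∣a*3^m+a a m)
    2∣t+a⇔2∣k : 2 ∣ t + a ⇔ 2 ∣ k
    2∣t+a⇔2∣k = mk⇔ (∣m+n∣m⇒∣n 2∣t+a+k) (λ 2∣k → ∣m+n∣m⇒∣n (subst (2 ∣_) (+-comm (t + a) k) 2∣t+a+k) 2∣k)

  -- The blocks a·3^(m−1) − 1 ≤ j ≤ a·3^m − 2

  hypRHS-equation-in-ℕ : ∀ {e A d m j k V W} →
    ℤ.+ e ≡ ℤ.+ A ℤ.- ℤ.+ d ℤ.* (ℤ.+ (j + k) ℤ.- ℤ.+ k) ℤ.+ ℤ.+ m ℤ.- ℤ.+ 1 ℤ.- ℤ.+ V ℤ.+ ℤ.+ W →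
    e + (d + m) * j + 1 + V ≡ A + m * j + m + W
  hypRHS-equation-in-ℕ {e} {A} {d} {m} {j} {k} {V} {W} h = ℤ.+-injective (begin
    + (e + (d + m) * j + 1 + V)
      ≡⟨ cong (λ x → + e ℤ.+ x ℤ.+ + 1 ℤ.+ + V) (ℤ.pos-* (d + m) j) ⟩
    + e ℤ.+ (+ d ℤ.+ + m) ℤ.* + j ℤ.+ + 1 ℤ.+ + V
      ≡⟨ cong (λ x → x ℤ.+ (+ d ℤ.+ + m) ℤ.* + j ℤ.+ + 1 ℤ.+ + V) h ⟩
    + A ℤ.- + d ℤ.* ((+ j ℤ.+ + k) ℤ.- + k) ℤ.+ + m ℤ.- + 1 ℤ.- + V ℤ.+ + W ℤ.+ (+ d ℤ.+ + m) ℤ.* + j ℤ.+ + 1 ℤ.+ + V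
      ≡⟨ ℤ-solve 7 (λ A d m j k V W → A ⊖ d ⊛ ((j ⊕ k) ⊖ k) ⊕ m ⊖ ℤ-con (+ 1) ⊖ V ⊕ W ⊕ (d ⊕ m) ⊛ j ⊕ ℤ-con (+ 1) ⊕ V
                                    ≐ A ⊕ m ⊛ j ⊕ m ⊕ W) refl (+ A) (+ d) (+ m) (+ j) (+ k) (+ V) (+ W) ⟩
    + A ℤ.+ + m ℤ.* + j ℤ.+ + m ℤ.+ + W
      ≡⟨ cong (λ x → + A ℤ.+ x ℤ.+ + m ℤ.+ + W) (ℤ.pos-* m j) ⟨
    + (A + m * j + m + W)
      ∎)
    where
    open ≡-Reasoning
    open import Data.Integer.Solver as ℤ-Solver using ()
    open ℤ-Solver.+-*-Solver using () renaming (solve to ℤ-solve; _:+_ to _⊕_; _:-_ to _⊖_; _:*_ to _⊛_; _:=_ to _≐_; con to ℤ-con)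
    +_ : ℕ → ℤ.ℤ
    +_ = ℤ.+_

  Hypothesis : ℕ → ℕ → Set
  Hypothesis a n = ∀ m k → 1 ≤ m → m ≤ n → 2 ≤ k → k ≤ 2 * a * 3 ^ (m ∸ 1) + 1 → k < a * 3 ^ m →
    ∃[ e ] (v3 (stirling (a * 3 ^ n) (a * 3 ^ m ∸ k)) ≡ fin e × ℤ.+ e ≡ hypRHS a n m k)

  module Blocks {a n : ℕ} (1≤a : 1 ≤ a) (a≤2 : a ≤ 2) (1≤n : 1 ≤ n) (hyp : Hypothesis a n) where

    N : ℕ
    N = a * 3 ^ n

    open ShiftValuation n N using (weight)

    P : ℕ → ℕ
    P m = a * 3 ^ m

    A : ℕ → ℕ
    A m = (a * (3 ^ n ∸ 3 ^ m)) / 2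

    V : ℕ → ℕ
    V k = v3ℕ (k / 2)

    W : ℕ → ℕ → ℕ
    W m k = (m + v3ℕ k) * ε k

    U : ℕ → ℕ
    U m = A m + m * P m

    P[1+m]≡3*Pm : ∀ m → P (suc m) ≡ 3 * P m
    P[1+m]≡3*Pm m = solve 2 (λ a x → a :* (con 3 :* x) := con 3 :* (a :* x)) refl a (3 ^ m)

    -- j = a3^m − k with (m,k) ∈ T_{a,n}
    record Coords (j m k : ℕ) : Set where
      field
        1≤m           : 1 ≤ m
        m≤n           : m ≤ n
        2≤k           : 2 ≤ k
        k≤2a3^[m∸1]+1 : k ≤ 2 * a * 3 ^ (m ∸ 1) + 1
        k<Pm          : k < P m
        j+k≡Pm        : j + k ≡ P m

    open Coords

    weight-formula : ∀ {j m k} → Coords j m k → weight j + 1 + V k ≡ A m + m * j + m + W m k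
    weight-formula {j} {m} {k} c with hyp m k (1≤m c) (m≤n c) (2≤k c) (k≤2a3^[m∸1]+1 c) (k<Pm c)
    ... | e , v3≡e , e≡rhs = begin
      v3ℕ (stirling N j) + n * j + 1 + V k  ≡⟨ cong₂ (λ x y → x + y * j + 1 + V k) v3ℕ≡e (sym (m∸n+n≡m (m≤n c))) ⟩
      e + (n ∸ m + m) * j + 1 + V k         ≡⟨ hypRHS-equation-in-ℕ {e} {A m} {n ∸ m} {m} {j} {k} {V k} {W m k}
                                                 (subst (λ x → ℤ.+ e ≡ hypRHS′ x) (sym (j+k≡Pm c)) e≡rhs) ⟩
      A m + m * j + m + W m k               ∎
      where
      open ≡-Reasoning
      P∸k≡j : P m ∸ k ≡ j
      P∸k≡j = trans (cong (_∸ k) (sym (j+k≡Pm c))) (m+n∸n≡m j k)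
      v3ℕ≡e : v3ℕ (stirling N j) ≡ e
      v3ℕ≡e = v3≡fin⇒v3ℕ≡ (subst (λ x → v3 (stirling N x) ≡ fin e) P∸k≡j v3≡e)
      hypRHS′ : ℕ → ℤ.ℤ
      hypRHS′ x = ℤ.+ A m ℤ.- ℤ.+ (n ∸ m) ℤ.* (ℤ.+ x ℤ.- ℤ.+ k) ℤ.+ ℤ.+ m ℤ.- ℤ.+ 1 ℤ.- ℤ.+ V k ℤ.+ ℤ.+ W m k

    k≤2P[m∸1]+1 : ∀ {j m k} → Coords j m k → k ≤ 2 * P (m ∸ 1) + 1
    k≤2P[m∸1]+1 {j} {m} {k} c = subst (λ x → k ≤ x + 1) (*-assoc 2 a (3 ^ (m ∸ 1))) (k≤2a3^[m∸1]+1 c)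

    P-mono : ∀ {m m′} → m ≤ m′ → P m ≤ P m′
    P-mono m≤m′ = *-monoʳ-≤ a (^-monoʳ-≤ 3 m≤m′)

    Pm≡3*P[m∸1] : ∀ {m} → 1 ≤ m → P m ≡ 3 * P (m ∸ 1)
    Pm≡3*P[m∸1] {suc m} _ = P[1+m]≡3*Pm m

    j+2≤Pm : ∀ {j m k} → Coords j m k → j + 2 ≤ P m
    j+2≤Pm {j} c = ≤-trans (+-monoʳ-≤ j (2≤k c)) (≤-reflexive (j+k≡Pm c))

    P[m∸1]≤j+1 : ∀ {j m k} → Coords j m k → P (m ∸ 1) ≤ j + 1
    P[m∸1]≤j+1 {j} {m} {k} c = +-cancelʳ-≤ (2 * Q) Q (j + 1) (begin
      Q + 2 * Q          ≡⟨ solve 1 (λ x → x :+ con 2 :* x := con 3 :* x) refl Q ⟩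
      3 * Q              ≡⟨ Pm≡3*P[m∸1] (1≤m c) ⟨
      P m                ≡⟨ j+k≡Pm c ⟨
      j + k              ≤⟨ +-monoʳ-≤ j (k≤2P[m∸1]+1 c) ⟩
      j + (2 * Q + 1)    ≡⟨ solve 2 (λ j x → j :+ (con 2 :* x :+ con 1) := j :+ con 1 :+ con 2 :* x) refl j Q ⟩
      j + 1 + 2 * Q      ∎)
      where
      open ≤-Reasoning
      Q = P (m ∸ 1)

    coords-monotone : ∀ {j m k j′ m′ k′} → Coords j m k → Coords j′ m′ k′ → j < j′ → m ≤ m′
    coords-monotone {j} {m} {k} {j′} {m′} c c′ j<j′ with m ≤? m′
    ... | yes m≤m′ = m≤m′
    ... | no  m≰m′ = contradiction (begin-strict
      P m′          ≤⟨ P-mono (∸-monoˡ-≤ 1 (≰⇒> m≰m′)) ⟩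
      P (m ∸ 1)     ≤⟨ P[m∸1]≤j+1 c ⟩
      j + 1         <⟨ +-monoˡ-< 1 j<j′ ⟩
      j′ + 1        <⟨ +-monoʳ-< j′ (n<1+n 1) ⟩
      j′ + 2        ≤⟨ j+2≤Pm c′ ⟩
      P m′          ∎) (<-irrefl refl)
      where open ≤-Reasoning

    V<m : ∀ {j m k} → Coords j m k → V k < m
    V<m {m = zero}  c = contradiction (1≤m c) λ ()
    V<m {m = suc m} {k} c with V k <? suc m
    ... | yes V<m = V<m
    ... | no  V≮m = contradiction (begin-strict
      3 ^ suc m   ≤⟨ ∣⇒≤ {{>-nonZero 0<k/2}} (∣-trans (^-monoʳ-∣ 3 (≮⇒≥ V≮m)) (3^v3ℕ∣ (k / 2))) ⟩
      k / 2       ≤⟨ k≤2x+1⇒k/2≤x (P m) (k≤2P[m∸1]+1 c) ⟩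
      a * 3 ^ m   ≤⟨ *-monoˡ-≤ (3 ^ m) a≤2 ⟩
      2 * 3 ^ m   <⟨ *-monoˡ-< (3 ^ m) {{m^n≢0 3 m}} (n<1+n 2) ⟩
      3 ^ suc m   ∎) (<-irrefl refl)
      where
      open ≤-Reasoning
      0<k/2 : 0 < k / 2
      0<k/2 = m≥n⇒m/n>0 (2≤k c)

    A-step : ∀ m → suc m ≤ n → A m ≡ A (suc m) + P m
    A-step m m<n = begin
      (a * (3 ^ n ∸ 3 ^ m)) / 2                 ≡⟨ cong (λ x → (a * x) / 2) 3ⁿ∸3ᵐ≡3ⁿ∸3ᵐ⁺¹+2*3ᵐ ⟩
      (a * (3 ^ n ∸ 3 ^ suc m + 2 * 3 ^ m)) / 2 ≡⟨ cong (_/ 2) (solve 3 (λ a x y → a :* (x :+ con 2 :* y) := a :* x :+ (a :* y) :* con 2)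
                                                                  refl a (3 ^ n ∸ 3 ^ suc m) (3 ^ m)) ⟩
      (a * (3 ^ n ∸ 3 ^ suc m) + P m * 2) / 2  ≡⟨ +-distrib-/-∣ʳ (a * (3 ^ n ∸ 3 ^ suc m)) (n∣m*n (P m)) ⟩
      A (suc m) + P m * 2 / 2                   ≡⟨ cong (A (suc m) +_) (m*n/n≡m (P m) 2) ⟩
      A (suc m) + P m                           ∎
      where
      open ≡-Reasoning
      3ⁿ∸3ᵐ≡3ⁿ∸3ᵐ⁺¹+2*3ᵐ : 3 ^ n ∸ 3 ^ m ≡ 3 ^ n ∸ 3 ^ suc m + 2 * 3 ^ m
      3ⁿ∸3ᵐ≡3ⁿ∸3ᵐ⁺¹+2*3ᵐ = begin
        3 ^ n ∸ 3 ^ m                                 ≡⟨ cong (_∸ 3 ^ m) (m∸n+n≡m (^-monoʳ-≤ 3 m<n)) ⟨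
        3 ^ n ∸ 3 ^ suc m + 3 * 3 ^ m ∸ 3 ^ m         ≡⟨ cong (_∸ 3 ^ m) (solve 2 (λ d x → d :+ con 3 :* x := d :+ con 2 :* x :+ x)
                                                                             refl (3 ^ n ∸ 3 ^ suc m) (3 ^ m)) ⟩
        3 ^ n ∸ 3 ^ suc m + 2 * 3 ^ m + 3 ^ m ∸ 3 ^ m ≡⟨ m+n∸n≡m _ (3 ^ m) ⟩
        3 ^ n ∸ 3 ^ suc m + 2 * 3 ^ m                 ∎

    U-top : U n ≡ n * N
    U-top = cong (λ x → x / 2 + n * N) (trans (cong (a *_) (n∸n≡0 (3 ^ n))) (*-zeroʳ a))

    U-step : ∀ m → suc m ≤ n → U m ≤ U (suc m)
    U-step m m<n = begin
      A m + m * P m                  ≡⟨ cong (_+ m * P m) (A-step m m<n) ⟩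
      A (suc m) + P m + m * P m      ≡⟨ +-assoc (A (suc m)) (P m) (m * P m) ⟩
      A (suc m) + suc m * P m        ≤⟨ +-monoʳ-≤ (A (suc m)) (*-monoʳ-≤ (suc m) (P-mono (n≤1+n m))) ⟩
      A (suc m) + suc m * P (suc m)  ∎
      where open ≤-Reasoning

    U-mono : ∀ {m m′} → m ≤ m′ → m′ ≤ n → U m ≤ U m′
    U-mono {m} {m′} m≤m′ m′≤n with m≤n⇒m<n∨m≡n m≤m′
    ... | inj₂ refl = ≤-refl
    U-mono {m} {suc m′} _ m′<n | inj₁ (s≤s m≤m′) = ≤-trans (U-mono m≤m′ (≤-trans (n≤1+n m′) m′<n)) (U-step m′ m′<n)

    W-even : ∀ m k → k % 2 ≡ 0 → W m k ≡ 0
    W-even m k k-even = trans (cong ((m + v3ℕ k) *_) k-even) (*-zeroʳ (m + v3ℕ k))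

    m≤W-odd : ∀ m k → k % 2 ≡ 1 → m ≤ W m k
    m≤W-odd m k k-odd = ≤-trans (m≤m+n m (v3ℕ k)) (≤-reflexive (sym (trans (cong ((m + v3ℕ k) *_) k-odd) (*-identityʳ _))))

    weight+2≤U : ∀ {j m k} → Coords j m k → k % 2 ≡ 0 → weight j + 2 ≤ U m
    weight+2≤U {j} {m} {k} c k-even = begin
      weight j + 2                       ≡⟨ +-assoc (weight j) 1 1 ⟨
      weight j + 1 + 1                   ≤⟨ +-mono-≤ (m≤m+n (weight j + 1) (V k)) (1≤m c) ⟩
      weight j + 1 + V k + m             ≡⟨ cong (_+ m) (weight-formula c) ⟩
      A m + m * j + m + W m k + m        ≡⟨ cong (λ x → A m + m * j + m + x + m) (W-even m k k-even) ⟩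
      A m + m * j + m + 0 + m            ≡⟨ solve 3 (λ A m j → A :+ m :* j :+ m :+ con 0 :+ m := A :+ m :* (j :+ con 2)) refl (A m) m j ⟩
      A m + m * (j + 2)                  ≤⟨ +-monoʳ-≤ (A m) (*-monoʳ-≤ m (j+2≤Pm c)) ⟩
      A m + m * P m                      ∎
      where open ≤-Reasoning

    Pm+2Pm≡j+k : ∀ {j m k} → Coords j (suc m) k → P m + 2 * P m ≡ j + k
    Pm+2Pm≡j+k {j} {m} {k} c =
      trans (solve 1 (λ x → x :+ con 2 :* x := con 3 :* x) refl (P m)) (trans (sym (P[1+m]≡3*Pm m)) (sym (j+k≡Pm c)))

    [1+m]Pm≤[1+m]j+W : ∀ {j m k} → Coords j (suc m) k → suc m * P m ≤ suc m * j + W (suc m) k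
    [1+m]Pm≤[1+m]j+W {j} {m} {k} c with k ≤? 2 * P m
    ... | yes k≤2Pm = ≤-trans (*-monoʳ-≤ (suc m) Pm≤j) (m≤m+n (suc m * j) (W (suc m) k))
      where
      Pm≤j : P m ≤ j
      Pm≤j = +-cancelʳ-≤ (2 * P m) (P m) j (≤-trans (≤-reflexive (Pm+2Pm≡j+k c)) (+-monoʳ-≤ j k≤2Pm))
    ... | no  k≰2Pm = begin
      suc m * P m              ≡⟨ cong (suc m *_) Pm≡j+1 ⟩
      suc m * (j + 1)          ≡⟨ solve 2 (λ sm j → sm :* (j :+ con 1) := sm :* j :+ sm) refl (suc m) j ⟩
      suc m * j + suc m        ≤⟨ +-monoʳ-≤ (suc m * j) (m≤W-odd (suc m) k (trans (cong (_% 2) k≡2Pm+1) ([2x+1]%2≡1 (P m)))) ⟩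
      suc m * j + W (suc m) k  ∎
      where
      open ≤-Reasoning
      k≡2Pm+1 : k ≡ 2 * P m + 1
      k≡2Pm+1 = ≤-antisym (k≤2P[m∸1]+1 c) (subst (_≤ k) (+-comm 1 (2 * P m)) (≰⇒> k≰2Pm))
      Pm≡j+1 : P m ≡ j + 1
      Pm≡j+1 = +-cancelʳ-≡ (2 * P m) (P m) (j + 1) (trans (Pm+2Pm≡j+k c)
        (trans (cong (j +_) k≡2Pm+1) (solve 2 (λ j x → j :+ (con 2 :* x :+ con 1) := j :+ con 1 :+ con 2 :* x) refl j (P m))))

    U≤weight-next : ∀ {j m k} → Coords j (suc m) k → U m ≤ weight j
    U≤weight-next {j} {m} {k} c = +-cancelʳ-≤ (suc m) (U m) (weight j) (begin
      A m + m * P m + suc m                         ≡⟨ cong (λ x → x + m * P m + suc m) (A-step m (m≤n c)) ⟩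
      A (suc m) + P m + m * P m + suc m             ≡⟨ solve 4 (λ A p m sm → A :+ p :+ m :* p :+ sm := A :+ (p :+ m :* p) :+ sm)
                                                         refl (A (suc m)) (P m) m (suc m) ⟩
      A (suc m) + suc m * P m + suc m               ≤⟨ +-monoˡ-≤ (suc m) (+-monoʳ-≤ (A (suc m)) ([1+m]Pm≤[1+m]j+W c)) ⟩
      A (suc m) + (suc m * j + W (suc m) k) + suc m ≡⟨ solve 4 (λ A x w sm → A :+ (x :+ w) :+ sm := A :+ x :+ sm :+ w)
                                                         refl (A (suc m)) (suc m * j) (W (suc m) k) (suc m) ⟩
      A (suc m) + suc m * j + suc m + W (suc m) k   ≡⟨ weight-formula c ⟨
      weight j + 1 + V k                            ≡⟨ +-assoc (weight j) 1 (V k) ⟩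
      weight j + suc (V k)                          ≤⟨ +-monoʳ-≤ (weight j) (V<m c) ⟩
      weight j + suc m                              ∎)
      where open ≤-Reasoning

    U≤weight : ∀ {j m m′ k} → Coords j m′ k → m < m′ → U m ≤ weight j
    U≤weight {m′ = suc m₀} c (s≤s m≤m₀) = ≤-trans (U-mono m≤m₀ (≤-trans (n≤1+n m₀) (m≤n c))) (U≤weight-next c)

    weight-gap-in-block : ∀ {j m k j′ k′} → Coords j m k → Coords j′ m k′ → k % 2 ≡ 0 → k′ < k →
                          weight j + 2 ≤ weight j′
    weight-gap-in-block {j} {m} {k} {j′} {k′} c c′ k-even k′<k = +-cancelʳ-≤ m (weight j + 2) (weight j′) (begin
      weight j + 2 + m                     ≡⟨ solve 2 (λ x m → x :+ con 2 :+ m := x :+ con 1 :+ con 0 :+ (con 1 :+ m)) refl (weight j) m ⟩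
      weight j + 1 + 0 + (1 + m)           ≤⟨ +-mono-≤ (+-monoʳ-≤ (weight j + 1) z≤n) (+-monoˡ-≤ m (1≤m c)) ⟩
      weight j + 1 + V k + (m + m)         ≡⟨ cong (_+ (m + m)) (weight-formula c) ⟩
      A m + m * j + m + W m k + (m + m)    ≡⟨ cong (λ x → A m + m * j + m + x + (m + m)) (W-even m k k-even) ⟩
      A m + m * j + m + 0 + (m + m)        ≤⟨ +-monoʳ-≤ (A m + m * j + m + 0) 2m≤md+W ⟩
      A m + m * j + m + 0 + (m * d + W m k′) ≡⟨ solve 5 (λ A m j d w → A :+ m :* j :+ m :+ con 0 :+ (m :* d :+ w)
                                                                  := A :+ m :* (j :+ d) :+ m :+ w) refl (A m) m j d (W m k′) ⟩
      A m + m * (j + d) + m + W m k′       ≡⟨ cong (λ x → A m + m * x + m + W m k′) j+d≡j′ ⟩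
      A m + m * j′ + m + W m k′            ≡⟨ weight-formula c′ ⟨
      weight j′ + 1 + V k′                 ≡⟨ +-assoc (weight j′) 1 (V k′) ⟩
      weight j′ + suc (V k′)               ≤⟨ +-monoʳ-≤ (weight j′) (V<m c′) ⟩
      weight j′ + m                        ∎)
      where
      open ≤-Reasoning
      d : ℕ
      d = k ∸ k′
      k′+d≡k : k′ + d ≡ k
      k′+d≡k = m+[n∸m]≡n (<⇒≤ k′<k)
      j+d≡j′ : j + d ≡ j′
      j+d≡j′ = +-cancelʳ-≡ k′ (j + d) j′ (begin-equality
        j + d + k′    ≡⟨ solve 3 (λ j d k′ → j :+ d :+ k′ := j :+ (k′ :+ d)) refl j d k′ ⟩
        j + (k′ + d)  ≡⟨ cong (j +_) k′+d≡k ⟩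
        j + k         ≡⟨ trans (j+k≡Pm c) (sym (j+k≡Pm c′)) ⟩
        j′ + k′       ∎)
      2m≤md+W : m + m ≤ m * d + W m k′
      2m≤md+W with d | k′+d≡k
      ... | zero        | k′+0≡k = contradiction (trans (sym (+-identityʳ k′)) k′+0≡k) (<⇒≢ k′<k)
      ... | suc zero    | k′+1≡k = +-mono-≤ (≤-reflexive (sym (*-identityʳ m)))
                                     (m≤W-odd m k′ (even⇒pred-odd k′ (subst (λ x → x % 2 ≡ 0) (sym (trans (+-comm 1 k′) k′+1≡k)) k-even)))
      ... | suc (suc d′) | _       = ≤-trans (≤-reflexive (solve 1 (λ m → m :+ m := m :* con 2) refl m))
                                     (≤-trans (*-monoʳ-≤ m (s≤s (s≤s z≤n))) (m≤m+n (m * suc (suc d′)) (W m k′)))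

    weight-odd-step : ∀ {j m k} → Coords j m (suc k) → Coords (suc j) m k → suc k % 2 ≡ 1 → weight (suc j) ≤ weight j
    weight-odd-step {j} {m} {k} c c′ k+1-odd = +-cancelʳ-≤ (1 + V k) (weight (suc j)) (weight j) (begin
      weight (suc j) + (1 + V k)          ≡⟨ +-assoc (weight (suc j)) 1 (V k) ⟨
      weight (suc j) + 1 + V k            ≡⟨ weight-formula c′ ⟩
      A m + m * suc j + m + W m k         ≡⟨ cong (A m + m * suc j + m +_) (W-even m k k-even) ⟩
      A m + m * suc j + m + 0             ≡⟨ solve 3 (λ A m j → A :+ m :* (con 1 :+ j) :+ m :+ con 0 := A :+ m :* j :+ m :+ m) refl (A m) m j ⟩
      A m + m * j + m + m                 ≤⟨ +-monoʳ-≤ (A m + m * j + m) (m≤W-odd m (suc k) k+1-odd) ⟩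
      A m + m * j + m + W m (suc k)       ≡⟨ weight-formula c ⟨
      weight j + 1 + V (suc k)            ≡⟨ cong (λ x → weight j + 1 + v3ℕ x) (even⇒[1+k]/2≡k/2 k k-even) ⟩
      weight j + 1 + V k                  ≡⟨ +-assoc (weight j) 1 (V k) ⟩
      weight j + (1 + V k)                ∎)
      where
      open ≤-Reasoning
      k-even : k % 2 ≡ 0
      k-even = odd⇒pred-even k k+1-odd

    coords-intro : ∀ {j m} → 1 ≤ m → m ≤ n → 1 ≤ j → j + 2 ≤ P m → P (m ∸ 1) ≤ j + 1 → Coords j m (P m ∸ j)
    coords-intro {j} {m} 1≤m m≤n 1≤j j+2≤Pm P[m∸1]≤j+1 = record
      { 1≤m = 1≤m ; m≤n = m≤n ; 2≤k = 2≤r ; k≤2a3^[m∸1]+1 = r≤2a3^[m∸1]+1 ; k<Pm = r<Pm ; j+k≡Pm = j+r≡Pm }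
      where
      open ≤-Reasoning
      r = P m ∸ j
      Q = P (m ∸ 1)
      j+r≡Pm : j + r ≡ P m
      j+r≡Pm = m+[n∸m]≡n (≤-trans (m≤m+n j 2) j+2≤Pm)
      2≤r : 2 ≤ r
      2≤r = +-cancelˡ-≤ j 2 r (≤-trans j+2≤Pm (≤-reflexive (sym j+r≡Pm)))
      r<Pm : r < P m
      r<Pm = ≤-trans (+-monoˡ-≤ r 1≤j) (≤-reflexive j+r≡Pm)
      r≤2a3^[m∸1]+1 : r ≤ 2 * a * 3 ^ (m ∸ 1) + 1
      r≤2a3^[m∸1]+1 = subst (λ x → r ≤ x + 1) (sym (*-assoc 2 a (3 ^ (m ∸ 1)))) (+-cancelˡ-≤ Q r (2 * Q + 1) (begin
        Q + r           ≤⟨ +-monoˡ-≤ r P[m∸1]≤j+1 ⟩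
        j + 1 + r       ≡⟨ solve 2 (λ j r → j :+ con 1 :+ r := (j :+ r) :+ con 1) refl j r ⟩
        j + r + 1       ≡⟨ cong (_+ 1) (trans j+r≡Pm (Pm≡3*P[m∸1] 1≤m)) ⟩
        3 * Q + 1       ≡⟨ solve 1 (λ x → con 3 :* x :+ con 1 := x :+ (con 2 :* x :+ con 1)) refl Q ⟩
        Q + (2 * Q + 1) ∎))

    coords-exist : ∀ {j} → 1 ≤ j → j + 2 ≤ N → ∃[ m ] ∃[ k ] Coords j m k
    coords-exist {j} 1≤j j+2≤N = search n 1≤n ≤-refl j+2≤N
      where
      search : ∀ m → 1 ≤ m → m ≤ n → j + 2 ≤ P m → ∃[ m′ ] ∃[ k ] Coords j m′ k
      search (suc m) 1≤m m≤n j+2≤Pm with P m ≤? j + 1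
      ... | yes Pm≤j+1 = suc m , P (suc m) ∸ j , coords-intro 1≤m m≤n 1≤j j+2≤Pm Pm≤j+1
      search (suc zero)    _ _   _ | no a≰j+1 = contradiction (≤-trans (≤-reflexive (*-identityʳ a)) (≤-trans a≤2 (+-monoˡ-≤ 1 1≤j))) a≰j+1
      search (suc (suc m)) _ m≤n _ | no P≰j+1 =
        search (suc m) (s≤s z≤n) (≤-trans (n≤1+n (suc m)) m≤n) (subst (_≤ P (suc m)) (sym (+-suc j 1)) (≰⇒> P≰j+1))

    coords-suc : ∀ {j m k} → Coords j m (suc k) → 2 ≤ k → Coords (suc j) m k
    coords-suc {j} {m} {k} c 2≤k = record
      { 1≤m = 1≤m c ; m≤n = m≤n c ; 2≤k = 2≤k ; k≤2a3^[m∸1]+1 = ≤-trans (n≤1+n k) (k≤2a3^[m∸1]+1 c)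
      ; k<Pm = ≤-trans (n≤1+n (suc k)) (k<Pm c) ; j+k≡Pm = trans (sym (+-suc j k)) (j+k≡Pm c) }

    weight-top : weight N ≡ n * N
    weight-top = cong (λ x → v3ℕ x + n * N) (stirlingM-diag 0 N)

    nN≤weight : ∀ {j} → j ≤ N → N ≤ j + 1 → n * N ≤ weight j
    nN≤weight {j} j≤N N≤j+1 with j ≟ N
    ... | yes refl = ≤-reflexive (sym weight-top)
    ... | no  j≢N  = begin
      n * N                        ≡⟨ cong (n *_) 1+j≡N ⟨
      n * suc j                    ≡⟨ *-suc n j ⟩
      n + n * j                    ≤⟨ +-monoˡ-≤ (n * j) n≤v3 ⟩
      v3ℕ (stirling N j) + n * j   ∎
      where
      open ≤-Reasoning
      1+j≡N : suc j ≡ N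
      1+j≡N = ≤-antisym (≤∧≢⇒< j≤N j≢N) (subst (N ≤_) (+-comm j 1) N≤j+1)
      2≤N : 2 ≤ N
      2≤N = ≤-trans (n≤1+n 2) (≤-trans (^-monoʳ-≤ 3 1≤n) (m≤n*m (3 ^ n) a {{>-nonZero 1≤a}}))
      n≤v3 : n ≤ v3ℕ (stirling N j)
      n≤v3 = subst (λ x → n ≤ v3ℕ (stirling x j)) 1+j≡N
        (3^e∣1+K⇒e≤v3[s[1+K,K]] n j (≤-pred (≤-trans 2≤N (≤-reflexive (sym 1+j≡N)))) (subst (3 ^ n ∣_) (sym 1+j≡N) (n∣m*n a)))

    weight-even-gap : ∀ {t m k} → Coords t m k → k % 2 ≡ 0 → ∀ j → t < j → j ≤ N → weight t + 2 ≤ weight j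
    weight-even-gap {t} {m} {k} c k-even j t<j j≤N with j + 2 ≤? N
    ... | no j+2≰N = begin
      weight t + 2  ≤⟨ weight+2≤U c k-even ⟩
      U m           ≤⟨ U-mono (m≤n c) ≤-refl ⟩
      U n           ≡⟨ U-top ⟩
      n * N         ≤⟨ nN≤weight j≤N (≤-pred (subst (N <_) (+-suc j 1) (≰⇒> j+2≰N))) ⟩
      weight j      ∎
      where open ≤-Reasoning
    ... | yes j+2≤N with coords-exist (≤-trans (s≤s z≤n) t<j) j+2≤N
    ...   | m′ , k′ , c′ with m≤n⇒m<n∨m≡n (coords-monotone c c′ t<j)
    ...     | inj₁ m<m′ = ≤-trans (weight+2≤U c k-even) (U≤weight c′ m<m′)
    ...     | inj₂ refl = weight-gap-in-block c c′ k-even k′<k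
      where
      k′<k : k′ < k
      k′<k = +-cancelˡ-< j k′ k (begin-strict
        j + k′  ≡⟨ trans (j+k≡Pm c′) (sym (j+k≡Pm c)) ⟩
        t + k   <⟨ +-monoˡ-< k t<j ⟩
        j + k   ∎)
        where open ≤-Reasoning

    weight-odd-min : ∀ {t m k} → Coords t m (suc k) → suc k % 2 ≡ 1 → ∀ j → t ≤ j → j ≤ N → weight (suc t) ≤ weight j
    weight-odd-min {t} {m} {k} c k+1-odd j t≤j j≤N with m≤n⇒m<n∨m≡n t≤j
    ... | inj₂ refl = weight-odd-step c (coords-suc c (odd⇒pred≥2 (2≤k c) k+1-odd)) k+1-odd
    ... | inj₁ t<j with m≤n⇒m<n∨m≡n t<j
    ...   | inj₂ refl  = ≤-refl
    ...   | inj₁ t+1<j = ≤-trans (m≤m+n (weight (suc t)) 2)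
                           (weight-even-gap (coords-suc c (odd⇒pred≥2 (2≤k c) k+1-odd)) (odd⇒pred-even k k+1-odd) j t+1<j j≤N)

    top-neighbour : ∀ {t} → t ≤ N → t ≢ N → ¬ (t + 2 ≤ N) → t + 1 ≡ N
    top-neighbour {t} t≤N t≢N t+2≰N =
      ≤-antisym (subst (_≤ N) (+-comm 1 t) (≤∧≢⇒< t≤N t≢N)) (≤-pred (subst (N <_) (+-suc t 1) (≰⇒> t+2≰N)))

    even⇒weight-gap : ∀ {t} → 1 ≤ t → t ≤ N → ℤ.+ 2 ℤ.∣ (ℤ.+ t ℤ.- ℤ.+ a) →
                      ∀ j → t < j → j ≤ N → weight t + 2 ≤ weight j
    even⇒weight-gap {t} 1≤t t≤N 2∣t-a with t + 2 ≤? N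
    ... | yes t+2≤N with coords-exist 1≤t t+2≤N
    ...   | m , k , c = weight-even-gap c (to (2∣[t-a]⇔k%2≡0 a m (j+k≡Pm c)) 2∣t-a)
    even⇒weight-gap {t} 1≤t t≤N 2∣t-a | no t+2≰N with t ≟ N
    ...   | yes refl = λ j N<j j≤N → contradiction j≤N (<⇒≱ N<j)
    ...   | no  t≢N  = contradiction (to (2∣[t-a]⇔k%2≡0 a n (top-neighbour t≤N t≢N t+2≰N)) 2∣t-a) λ ()

    odd⇒weight-minimal : ∀ {t} → 1 ≤ t → t ≤ N → ¬ (ℤ.+ 2 ℤ.∣ (ℤ.+ t ℤ.- ℤ.+ a)) →
                         t < N × (∀ j → t ≤ j → j ≤ N → weight (suc t) ≤ weight j)
    odd⇒weight-minimal {t} 1≤t t≤N 2∤t-a with t + 2 ≤? N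
    ... | yes t+2≤N with coords-exist 1≤t t+2≤N
    ...   | m , zero  , c = contradiction (2≤k c) λ ()
    ...   | m , suc k , c with k%2≡0⊎k%2≡1 (suc k)
    ...     | inj₁ k+1-even = contradiction (from (2∣[t-a]⇔k%2≡0 a m (j+k≡Pm c)) k+1-even) 2∤t-a
    ...     | inj₂ k+1-odd  = <-≤-trans (m<m+n t (s≤s z≤n)) t+2≤N , weight-odd-min c k+1-odd
    odd⇒weight-minimal {t} 1≤t t≤N 2∤t-a | no t+2≰N with t ≟ N
    ...   | yes refl = contradiction (from (2∣[t-a]⇔k%2≡0 a n (+-identityʳ N)) refl) 2∤t-a
    ...   | no  t≢N  = ≤∧≢⇒< t≤N t≢N , λ j t≤j j≤N → begin
      weight (suc t)  ≡⟨ cong weight (trans (+-comm 1 t) t+1≡N) ⟩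
      weight N        ≡⟨ weight-top ⟩
      n * N           ≤⟨ nN≤weight j≤N (≤-trans (≤-reflexive (sym t+1≡N)) (+-monoˡ-≤ 1 t≤j)) ⟩
      weight j        ∎
      where
      open ≤-Reasoning
      t+1≡N : t + 1 ≡ N
      t+1≡N = top-neighbour t≤N t≢N t+2≰N

open import Defs
open import Data.Nat using (ℕ; suc; _+_; _*_; _∸_; _^_; _≤_; _<_; s≤s; z≤n)
open import Data.Nat.Properties using (≤-refl)
open import Data.Integer using (ℤ; +_; _-_)
open import Data.Integer.Divisibility using (_∣_)
open import Data.Product using (_×_; _,_; proj₁; proj₂; ∃-syntax)
open import Data.Sum using (_⊎_; inj₁; inj₂)
open import Relation.Nullary using (¬_)
open import Relation.Binary.PropositionalEquality using (_≡_; refl)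
open Stirling3Adic

lemma2p6 : (a n t : ℕ) → (a ≡ 1 ⊎ a ≡ 2) → 1 ≤ n → 1 ≤ t → t ≤ a * 3 ^ n →
    (∀ m k → 1 ≤ m → m ≤ n → 2 ≤ k → k ≤ 2 * a * 3 ^ (m ∸ 1) + 1 → k < a * 3 ^ m →
      ∃[ e ] (v3 (stirling (a * 3 ^ n) (a * 3 ^ m ∸ k)) ≡ fin e × + e ≡ hypRHS a n m k)) →
    ((+ 2 ∣ (+ t - + a)) →
      (v3 (stirlingM (3 ^ n) (a * 3 ^ n) t) ≡ v3 (stirling (a * 3 ^ n) t))
      × (v3 (stirling (a * 3 ^ n) t) +∞ 2
          ≤∞ v3ℤ (+ stirlingM (3 ^ n) (a * 3 ^ n) t - + stirling (a * 3 ^ n) t)))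
    × (¬ (+ 2 ∣ (+ t - + a)) →
      v3 (stirling (a * 3 ^ n) (suc t)) +∞ n ≤∞ v3 (stirlingM (3 ^ n) (a * 3 ^ n) t))
lemma2p6 a n t a≡1⊎a≡2 1≤n 1≤t t≤N hyp =
    (λ 2∣t-a → v3-stirlingM-gap (stirling-pos 1≤t t≤N) (even⇒weight-gap 1≤t t≤N 2∣t-a))
  , (λ 2∤t-a → let t<N , minimal = odd⇒weight-minimal 1≤t t≤N 2∤t-a in
               v3-stirlingM-lower (stirling-pos (s≤s z≤n) t<N) minimal)
  where
  1≤a≤2 : ∀ {b} → b ≡ 1 ⊎ b ≡ 2 → 1 ≤ b × b ≤ 2
  1≤a≤2 (inj₁ refl) = ≤-refl , s≤s z≤n
  1≤a≤2 (inj₂ refl) = s≤s z≤n , ≤-refl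
  open Blocks (proj₁ (1≤a≤2 a≡1⊎a≡2)) (proj₂ (1≤a≤2 a≡1⊎a≡2)) 1≤n hyp
  open ShiftValuation n (a * 3 ^ n)
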